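{- Let $\Omega$ be a connected $k$-orbigraph with $n$ vertices. Then its Cheeger constant satisfies $h(\Omega)\ge \dfrac{2}{n^2k^n}$.
   Context: A $k$-orbigraph is a finite weighted directed graph $\Omega$ (loops allowed) on vertices $1,\dots,n$ whose adjacency matrix $A$ ($A_{ij}$ = weight of the directed edge $(i,j)$, $0$ if absent) satisfies: $A_{ij}\in\mathbb{Z}_{\ge 0}$; $\sum_j A_{ij}=k$ for every $i$; and $A_{ij}>0$ iff $A_{ji}>0$. It is connected if its underlying graph is connected (equivalently, strongly connected). Let $P=\frac1k A$ (a stochastic matrix) and let $\pi=(\pi_1,\dots,\pi_n)$ be its unique stationary distribution ($\pi P=\pi$, $\sum_i\pi_i=1$). Define $F(i,j)=\pi_iP_{ij}$ and $F(j)=\sum_{i:\,i\to j}F(i,j)$, the sum over vertices $i$ with an edge $(i,j)$. The Cheeger constant is $$h(\Omega)=\inf_S \frac{\sum_{i\in S,\, j\notin S}F(i,j)}{\min\{\sum_{j\in S}F(j),\ \sum_{j\in\bar S}F(j)\}},$$ where $S$ ranges over nonempty proper subsets of the vertex set and $\bar S$ is the complement of $S$. -}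

module Defs where

open import Data.Nat as ℕ using (ℕ; zero; suc; NonZero; _^_)
open import Data.Nat.Properties using (m*n≢0; m^n≢0)
open import Data.Integer using (+_)
open import Data.Rational using (ℚ; 0ℚ; _/_; _⊓_) renaming (_+_ to _+ℚ_; _*_ to _*ℚ_)
open import Data.Fin using (Fin; zero; suc)
open import Data.Bool using (Bool; true; false; not; if_then_else_)
open import Data.Product using (∃)
open import Relation.Binary.PropositionalEquality using (_≡_)

sumℕ : ∀ {n} → (Fin n → ℕ) → ℕ
sumℕ {zero} f = 0
sumℕ {suc n} f = f zero ℕ.+ sumℕ (λ i → f (suc i))

sumℚ : ∀ {n} → (Fin n → ℚ) → ℚ
sumℚ {zero} f = 0ℚ
sumℚ {suc n} f = f zero +ℚ sumℚ (λ i → f (suc i))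

Matrix : ℕ → Set
Matrix n = Fin n → Fin n → ℕ

record IsOrbigraph (n k : ℕ) (A : Matrix n) : Set where
  field
    rowSum : ∀ i → sumℕ (A i) ≡ k
    symSupport : ∀ i j → 0 ℕ.< A i j → 0 ℕ.< A j i

data Reach {n : ℕ} (A : Matrix n) : Fin n → Fin n → Set where
  here : ∀ {i} → Reach A i i
  step : ∀ {i l j} → 0 ℕ.< A i l → Reach A l j → Reach A i j

Connected : ∀ {n} → Matrix n → Set
Connected {n} A = ∀ (i j : Fin n) → Reach A i j

P : ∀ {n} (k : ℕ) .{{_ : NonZero k}} → Matrix n → Fin n → Fin n → ℚ
P k A i j = (+ A i j) / k

record IsStationary {n} (k : ℕ) .{{_ : NonZero k}} (A : Matrix n) (π : Fin n → ℚ) : Set where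
  field
    nonneg : ∀ i → 0ℚ Data.Rational.≤ π i
    invariant : ∀ j → sumℚ (λ i → π i *ℚ P k A i j) ≡ π j
    normalised : sumℚ π ≡ Data.Rational.1ℚ

Fe : ∀ {n} (k : ℕ) .{{_ : NonZero k}} → Matrix n → (Fin n → ℚ) → Fin n → Fin n → ℚ
Fe k A π i j = π i *ℚ P k A i j

Fv : ∀ {n} (k : ℕ) .{{_ : NonZero k}} → Matrix n → (Fin n → ℚ) → Fin n → ℚ
Fv k A π j = sumℚ (λ i → if A i j ℕ.≡ᵇ 0 then 0ℚ else Fe k A π i j)

Subset : ℕ → Set
Subset n = Fin n → Bool

boundary : ∀ {n} (k : ℕ) .{{_ : NonZero k}} → Matrix n → (Fin n → ℚ) → Subset n → ℚ
boundary k A π S = sumℚ (λ i → sumℚ (λ j →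
  if S i then (if S j then 0ℚ else Fe k A π i j) else 0ℚ))

volume : ∀ {n} (k : ℕ) .{{_ : NonZero k}} → Matrix n → (Fin n → ℚ) → Subset n → ℚ
volume k A π S = sumℚ (λ j → if S j then Fv k A π j else 0ℚ)

NonemptyProper : ∀ {n} → Subset n → Set
NonemptyProper S = ∃ (λ i → S i ≡ true) Data.Product.× ∃ (λ j → S j ≡ false)

-- h(Ω) ≥ c  ⟺  for every nonempty proper S, ratio(S) ≥ c
-- (denominator cleared; it is positive for connected orbigraphs)
CheegerAtLeast : ∀ {n} (k : ℕ) .{{_ : NonZero k}} → Matrix n → (Fin n → ℚ) → ℚ → Set
CheegerAtLeast {n} k A π c = ∀ (S : Subset n) → NonemptyProper S →
  c *ℚ (volume k A π S ⊓ volume k A π (λ j → not (S j))) Data.Rational.≤ boundary k A π S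

bound : (n k : ℕ) .{{_ : NonZero n}} .{{_ : NonZero k}} → ℚ
bound n k = _/_ (+ 2) (n ^ 2 ℕ.* k ^ n) {{m*n≢0 (n ^ 2) (k ^ n) {{m^n≢0 n 2}} {{m^n≢0 k n}}}}

-- Let π be maximal at i₀, so π i₀ ≥ 1/n. Stationarity gives π w ≥ π u P u w ≥ π u / k along
-- every edge u → w, and the sets {v | π i₀ ≤ kᵈ π v} grow strictly with d until they contain
-- every vertex (by connectivity some edge leaves them), so π v ≥ 1/(n kⁿ⁻¹) for all v. Hence
-- every edge carries flow F(i,j) ≥ 1/(n kⁿ). A nonempty proper S is left by some edge, so its
-- boundary is at least 1/(n kⁿ) ≥ 2/(n² kⁿ), while both volumes are at most 1.
module Submission where

open import Defs
open import Data.Nat as ℕ using (ℕ; NonZero; zero; suc; _^_; s≤s; z≤n)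
import Data.Nat.Properties as ℕ
open import Data.Nat.Solver using (module +-*-Solver)
open import Data.Integer as ℤ using (+_)
import Data.Integer.Properties as ℤ
open import Data.Rational as ℚ using (ℚ; 0ℚ; 1ℚ; _≤_; _*_; _+_; _/_; _⊓_; toℚᵘ; fromℚᵘ; NonNegative; Positive)
import Data.Rational.Properties as ℚ
open import Data.Rational.Unnormalised as ℚᵘ using (mkℚᵘ; _≃_)
import Data.Rational.Unnormalised.Properties as ℚᵘ
open import Data.Fin using (Fin; zero; suc)
open import Data.Fin.Properties using (all?; ¬∀⟶∃¬; nonZeroIndex)
open import Data.Fin.Subset as Sub using (_∈_; _∉_; _⊆_; ∣_∣)
open import Data.Fin.Subset.Properties using (∈⊤; ∣p∣≤n; ∣p∣≡n⇒p≡⊤; p⊂q⇒∣p∣<∣q∣; x∈p⇒∣p-x∣<∣p∣; _∈?_)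
open import Data.Vec using (tabulate; lookup)
open import Data.Vec.Properties using (lookup∘tabulate; []=⇒lookup; lookup⇒[]=)
open import Data.Bool using (true; false; not; if_then_else_; _≟_)
open import Data.Bool.Properties using (not-¬; ¬-not)
open import Data.Empty using (⊥-elim)
open import Data.Sum using (_⊎_; inj₁; inj₂)
open import Data.Product using (∃; ∃₂; _×_; _,_; proj₁; proj₂)
open import Function using (_∘_; _⇔_; mk⇔; Equivalence)
open import Relation.Nullary using (Dec; yes; no; does; ¬_)
open import Relation.Nullary.Decidable using (dec-true)
open import Relation.Unary using (Pred; Decidable)
open import Relation.Binary.PropositionalEquality

≃⇒≡fromℚᵘ : ∀ p u → toℚᵘ p ≃ u → p ≡ fromℚᵘ u
≃⇒≡fromℚᵘ p u p≃u = trans (sym (ℚ.fromℚᵘ-toℚᵘ p)) (ℚ.fromℚᵘ-cong p≃u)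

-- Opaque so that unification never unfolds fromℕ into normalisation code.
opaque
  fromℕ : ℕ → ℚ
  fromℕ m = + m / 1

  toℚᵘ-fromℕ : ∀ m → toℚᵘ (fromℕ m) ≃ mkℚᵘ (+ m) 0
  toℚᵘ-fromℕ m = ℚ.toℚᵘ-fromℚᵘ (mkℚᵘ (+ m) 0)

  fromℕ-* : ∀ a b → fromℕ (a ℕ.* b) ≡ fromℕ a * fromℕ b
  fromℕ-* a b = sym (≃⇒≡fromℚᵘ (fromℕ a * fromℕ b) (mkℚᵘ (+ (a ℕ.* b)) 0) (ℚᵘ.≃-trans (ℚ.toℚᵘ-homo-* (fromℕ a) (fromℕ b))
    (ℚᵘ.≃-trans (ℚᵘ.*-cong (toℚᵘ-fromℕ a) (toℚᵘ-fromℕ b))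
      (ℚᵘ.*≡* (cong (ℤ._* + 1) (sym (ℤ.pos-* a b)))))))

  fromℕ-+ : ∀ a b → fromℕ (a ℕ.+ b) ≡ fromℕ a + fromℕ b
  fromℕ-+ a b = sym (≃⇒≡fromℚᵘ (fromℕ a + fromℕ b) (mkℚᵘ (+ (a ℕ.+ b)) 0) (ℚᵘ.≃-trans (ℚ.toℚᵘ-homo-+ (fromℕ a) (fromℕ b))
    (ℚᵘ.≃-trans (ℚᵘ.+-cong (toℚᵘ-fromℕ a) (toℚᵘ-fromℕ b))
      (ℚᵘ.*≡* (cong (ℤ._* + 1) (trans (cong₂ ℤ._+_ (ℤ.*-identityʳ (+ a)) (ℤ.*-identityʳ (+ b)))
                                        (sym (ℤ.pos-+ a b))))))))

  fromℕ-mono-≤ : ∀ {a b} → a ℕ.≤ b → fromℕ a ≤ fromℕ b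
  fromℕ-mono-≤ {a} {b} a≤b = ℚ.toℚᵘ-cancel-≤
    (ℚᵘ.≤-respˡ-≃ (ℚᵘ.≃-sym (toℚᵘ-fromℕ a)) (ℚᵘ.≤-respʳ-≃ (ℚᵘ.≃-sym (toℚᵘ-fromℕ b))
      (ℚᵘ.*≤* (ℤ.*-monoʳ-≤-nonNeg (+ 1) (ℤ.+≤+ a≤b)))))

  /-*-fromℕ : ∀ a b .{{_ : NonZero b}} → (+ a / b) * fromℕ b ≡ fromℕ a
  /-*-fromℕ a b@(suc _) = ≃⇒≡fromℚᵘ _ (mkℚᵘ (+ a) 0) (ℚᵘ.≃-trans (ℚ.toℚᵘ-homo-* (+ a / b) (fromℕ b))
    (ℚᵘ.≃-trans (ℚᵘ.*-cong (ℚ.toℚᵘ-fromℚᵘ (mkℚᵘ (+ a) (ℕ.pred b))) (toℚᵘ-fromℕ b))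
      (ℚᵘ.*≡* (trans (ℤ.*-identityʳ _) (cong (λ m → + a ℤ.* + m) (sym (ℕ.*-identityʳ b)))))))

  instance
    fromℕ-nonNeg : ∀ {m} → NonNegative (fromℕ m)
    fromℕ-nonNeg {m} = ℚ.normalize-nonNeg m 1

  fromℕ-0 : fromℕ 0 ≡ 0ℚ
  fromℕ-0 = refl

  fromℕ-1 : fromℕ 1 ≡ 1ℚ
  fromℕ-1 = refl

  fromℕ-pos : ∀ m .{{_ : NonZero m}} → Positive (fromℕ m)
  fromℕ-pos m = ℚ.normalize-pos m 1

sumℚ-nonNeg : ∀ {n} (f : Fin n → ℚ) → (∀ i → 0ℚ ≤ f i) → 0ℚ ≤ sumℚ f
sumℚ-nonNeg {zero} f f≥0 = ℚ.≤-refl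
sumℚ-nonNeg {suc n} f f≥0 = ℚ.+-mono-≤ (f≥0 zero) (sumℚ-nonNeg (f ∘ suc) (f≥0 ∘ suc))

sumℚ-mono-≤ : ∀ {n} {f g : Fin n → ℚ} → (∀ i → f i ≤ g i) → sumℚ f ≤ sumℚ g
sumℚ-mono-≤ {zero} f≤g = ℚ.≤-refl
sumℚ-mono-≤ {suc n} f≤g = ℚ.+-mono-≤ (f≤g zero) (sumℚ-mono-≤ (f≤g ∘ suc))

term≤sumℚ : ∀ {n} (f : Fin n → ℚ) → (∀ i → 0ℚ ≤ f i) → ∀ i → f i ≤ sumℚ f
term≤sumℚ f f≥0 zero = begin
  f zero           ≡⟨ ℚ.+-identityʳ (f zero) ⟨
  f zero + 0ℚ      ≤⟨ ℚ.+-mono-≤ (ℚ.≤-refl {f zero}) (sumℚ-nonNeg (f ∘ suc) (f≥0 ∘ suc)) ⟩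
  sumℚ f           ∎
  where open ℚ.≤-Reasoning
term≤sumℚ f f≥0 (suc i) = begin
  f (suc i)                ≤⟨ term≤sumℚ (f ∘ suc) (f≥0 ∘ suc) i ⟩
  sumℚ (f ∘ suc)           ≡⟨ ℚ.+-identityˡ _ ⟨
  0ℚ + sumℚ (f ∘ suc)      ≤⟨ ℚ.+-mono-≤ (f≥0 zero) ℚ.≤-refl ⟩
  sumℚ f                   ∎
  where open ℚ.≤-Reasoning

sumℚ≤const*size : ∀ {n} (f : Fin n → ℚ) c → (∀ i → f i ≤ c) → sumℚ f ≤ c * fromℕ n
sumℚ≤const*size {zero} f c f≤c = ℚ.≤-reflexive (sym (trans (cong (c *_) fromℕ-0) (ℚ.*-zeroʳ c)))
sumℚ≤const*size {suc n} f c f≤c = begin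
  f zero + sumℚ (f ∘ suc)   ≤⟨ ℚ.+-mono-≤ (f≤c zero) (sumℚ≤const*size (f ∘ suc) c (f≤c ∘ suc)) ⟩
  c + c * fromℕ n            ≡⟨ cong (_+ c * fromℕ n) (trans (cong (c *_) fromℕ-1) (ℚ.*-identityʳ c)) ⟨
  c * fromℕ 1 + c * fromℕ n  ≡⟨ ℚ.*-distribˡ-+ c (fromℕ 1) (fromℕ n) ⟨
  c * (fromℕ 1 + fromℕ n)    ≡⟨ cong (c *_) (fromℕ-+ 1 n) ⟨
  c * fromℕ (suc n)         ∎
  where open ℚ.≤-Reasoning

argmax : ∀ {n} (f : Fin (suc n) → ℚ) → ∃ λ i → ∀ j → f j ≤ f i
argmax {zero} f = zero , λ { zero → ℚ.≤-refl }
argmax {suc n} f with argmax (f ∘ suc)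
... | m , f≤fm with ℚ.≤-total (f zero) (f (suc m))
... | inj₁ f0≤fm = suc m , λ { zero → f0≤fm ; (suc j) → f≤fm j }
... | inj₂ fm≤f0 = zero , λ { zero → ℚ.≤-refl ; (suc j) → ℚ.≤-trans (f≤fm j) fm≤f0 }

subsetOf : ∀ {n p} {P : Pred (Fin n) p} → Decidable P → Sub.Subset n
subsetOf P? = tabulate (does ∘ P?)

∈-subsetOf : ∀ {n p} {P : Pred (Fin n) p} (P? : Decidable P) {x} → x ∈ subsetOf P? ⇔ P x
∈-subsetOf P? {x} = mk⇔ (witness (P? x) ∘ lookup-does ∘ []=⇒lookup)
                        (lookup⇒[]= x _ ∘ trans (lookup∘tabulate (does ∘ P?) x) ∘ dec-true (P? x))
  where
  lookup-does : lookup (subsetOf P?) x ≡ true → does (P? x) ≡ true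
  lookup-does = trans (sym (lookup∘tabulate (does ∘ P?) x))
  witness : ∀ {A : Set _} (a? : Dec A) → does a? ≡ true → A
  witness (yes a) _ = a
  witness (no _) ()

module GrowingChain {n} (p : ℕ → Sub.Subset n) {x₀} (x₀∈p₀ : x₀ ∈ p 0)
                    (p-mono : ∀ d → p d ⊆ p (suc d))
                    (p-grow : ∀ d {x} → x ∉ p d → ∃ λ y → y ∈ p (suc d) × y ∉ p d) where

  ∣p∣>d-or-full : ∀ d → d ℕ.< ∣ p d ∣ ⊎ (∀ x → x ∈ p d)
  ∣p∣>d-or-full zero = inj₁ (ℕ.≤-trans (s≤s z≤n) (x∈p⇒∣p-x∣<∣p∣ x₀∈p₀))
  ∣p∣>d-or-full (suc d) with all? (_∈? p d)
  ... | yes full = inj₂ (λ x → p-mono d (full x))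
  ... | no ¬full with ¬∀⟶∃¬ n _ (_∈? p d) ¬full | ∣p∣>d-or-full d
  ...   | x , x∉pd | inj₂ full = ⊥-elim (x∉pd (full x))
  ...   | x , x∉pd | inj₁ d<∣pd∣ =
    inj₁ (ℕ.≤-trans (s≤s d<∣pd∣) (p⊂q⇒∣p∣<∣q∣ (p-mono d , p-grow d x∉pd)))

  saturated : ∀ x → x ∈ p (ℕ.pred n)
  saturated x with ∣p∣>d-or-full (ℕ.pred n)
  ... | inj₂ full = full x
  ... | inj₁ pred-n<∣p∣ = subst (x ∈_) (sym (∣p∣≡n⇒p≡⊤ ∣p∣≡n)) ∈⊤
    where
    instance _ = nonZeroIndex x
    n≤∣p∣ : n ℕ.≤ ∣ p (ℕ.pred n) ∣
    n≤∣p∣ = subst (ℕ._≤ ∣ p (ℕ.pred n) ∣) (ℕ.suc-pred n) pred-n<∣p∣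
    ∣p∣≡n : ∣ p (ℕ.pred n) ∣ ≡ n
    ∣p∣≡n = ℕ.≤-antisym (∣p∣≤n (p (ℕ.pred n))) n≤∣p∣

walk-crosses : ∀ {n ℓ} {A : Matrix n} {P : Pred (Fin n) ℓ} → Decidable P → ∀ {u v} →
               Reach A u v → P u → ¬ P v → ∃₂ λ i j → P i × ¬ P j × 0 ℕ.< A i j
walk-crosses P? here Pu ¬Pv = ⊥-elim (¬Pv Pu)
walk-crosses P? {u} (step {l = l} u→l walk) Pu ¬Pv with P? l
... | yes Pl = walk-crosses P? walk Pl ¬Pv
... | no ¬Pl = u , l , Pu , ¬Pl , u→l

module _ {n} {A : Matrix n} (conn : Connected A) (f : Fin n → ℚ) (f≥0 : ∀ i → 0ℚ ≤ f i)
         (c : ℕ) .{{_ : NonZero c}} (f-edge : ∀ {u w} → 0 ℕ.< A u w → f u ≤ f w * fromℕ c) where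

  private
    layer : Fin n → ℕ → Sub.Subset n
    layer i d = subsetOf (λ v → f i ℚ.≤? f v * fromℕ (c ^ d))

    ∈layer⁻ : ∀ i d {v} → v ∈ layer i d → f i ≤ f v * fromℕ (c ^ d)
    ∈layer⁻ i d = Equivalence.to (∈-subsetOf (λ v → f i ℚ.≤? f v * fromℕ (c ^ d)))

    ∈layer⁺ : ∀ i d {v} → f i ≤ f v * fromℕ (c ^ d) → v ∈ layer i d
    ∈layer⁺ i d = Equivalence.from (∈-subsetOf (λ v → f i ℚ.≤? f v * fromℕ (c ^ d)))

    *c^-mono : ∀ v {d e} → d ℕ.≤ e → f v * fromℕ (c ^ d) ≤ f v * fromℕ (c ^ e)
    *c^-mono v d≤e = ℚ.*-monoˡ-≤-nonNeg (f v) {{ℚ.nonNegative (f≥0 v)}} (fromℕ-mono-≤ (ℕ.^-monoʳ-≤ c d≤e))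

    self∈layer : ∀ i d → i ∈ layer i d
    self∈layer i d = ∈layer⁺ i d (ℚ.≤-trans (ℚ.≤-reflexive f≡f*c^0) (*c^-mono i {0} {d} z≤n))
      where f≡f*c^0 = sym (trans (cong (f i *_) fromℕ-1) (ℚ.*-identityʳ (f i)))

    layer-mono : ∀ i d → layer i d ⊆ layer i (suc d)
    layer-mono i d {v} v∈ = ∈layer⁺ i (suc d) (ℚ.≤-trans (∈layer⁻ i d v∈) (*c^-mono v {d} {suc d} (ℕ.n≤1+n d)))

    layer-edge : ∀ i d {u w} → u ∈ layer i d → 0 ℕ.< A u w → w ∈ layer i (suc d)
    layer-edge i d {u} {w} u∈ u→w = ∈layer⁺ i (suc d) (begin
      f i                             ≤⟨ ∈layer⁻ i d u∈ ⟩
      f u * fromℕ (c ^ d)             ≤⟨ ℚ.*-monoʳ-≤-nonNeg (fromℕ (c ^ d)) (f-edge u→w) ⟩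
      f w * fromℕ c * fromℕ (c ^ d)   ≡⟨ ℚ.*-assoc (f w) (fromℕ c) (fromℕ (c ^ d)) ⟩
      f w * (fromℕ c * fromℕ (c ^ d)) ≡⟨ cong (f w *_) (fromℕ-* c (c ^ d)) ⟨
      f w * fromℕ (c ^ suc d)         ∎)
      where open ℚ.≤-Reasoning

    layer-grow : ∀ i d {x} → x ∉ layer i d → ∃ λ y → y ∈ layer i (suc d) × y ∉ layer i d
    layer-grow i d {x} x∉ with walk-crosses (_∈? layer i d) (conn i x) (self∈layer i d) x∉
    ... | u , w , u∈ , w∉ , u→w = w , layer-edge i d u∈ u→w , w∉

  ratio-bound : ∀ i v → f i ≤ f v * fromℕ (c ^ ℕ.pred n)
  ratio-bound i v = ∈layer⁻ i (ℕ.pred n) (GrowingChain.saturated (layer i) (self∈layer i 0) (layer-mono i) (layer-grow i) v)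

if-preserves : ∀ {a ℓ} {X : Set a} (P : X → Set ℓ) b {x y} → P x → P y → P (if b then x else y)
if-preserves P true Px Py = Px
if-preserves P false Px Py = Py

module Stationary {n} (k : ℕ) .{{_ : NonZero k}} (A : Matrix n) (π : Fin n → ℚ)
                  (stationary : IsStationary k A π) where
  open IsStationary stationary

  Fe-nonNeg : ∀ i j → 0ℚ ≤ Fe k A π i j
  Fe-nonNeg i j = ℚ.nonNegative⁻¹ _ {{ℚ.nonNeg*nonNeg⇒nonNeg (π i) {{ℚ.nonNegative (nonneg i)}}
                                                             (P k A i j) {{ℚ.normalize-nonNeg (A i j) k}}}}

  Fe≤π : ∀ i j → Fe k A π i j ≤ π j
  Fe≤π i j = ℚ.≤-trans (term≤sumℚ (λ i → Fe k A π i j) (λ i → Fe-nonNeg i j) i) (ℚ.≤-reflexive (invariant j))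

  π≤Fe*k : ∀ {i j} → 0 ℕ.< A i j → π i ≤ Fe k A π i j * fromℕ k
  π≤Fe*k {i} {j} i→j = begin
    π i                          ≡⟨ trans (cong (π i *_) fromℕ-1) (ℚ.*-identityʳ (π i)) ⟨
    π i * fromℕ 1                ≤⟨ ℚ.*-monoˡ-≤-nonNeg (π i) {{ℚ.nonNegative (nonneg i)}} (fromℕ-mono-≤ i→j) ⟩
    π i * fromℕ (A i j)          ≡⟨ cong (π i *_) (/-*-fromℕ (A i j) k) ⟨
    π i * (P k A i j * fromℕ k)  ≡⟨ ℚ.*-assoc (π i) (P k A i j) (fromℕ k) ⟨
    Fe k A π i j * fromℕ k       ∎
    where open ℚ.≤-Reasoning

  π-edge : ∀ {i j} → 0 ℕ.< A i j → π i ≤ π j * fromℕ k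
  π-edge {i} {j} i→j = ℚ.≤-trans (π≤Fe*k i→j) (ℚ.*-monoʳ-≤-nonNeg (fromℕ k) (Fe≤π i j))

  Fv≤π : ∀ j → Fv k A π j ≤ π j
  Fv≤π j = ℚ.≤-trans (sumℚ-mono-≤ (λ i → if-preserves (_≤ Fe k A π i j) (A i j ℕ.≡ᵇ 0) (Fe-nonNeg i j) ℚ.≤-refl))
                     (ℚ.≤-reflexive (invariant j))

  volume≤1 : ∀ S → volume k A π S ≤ 1ℚ
  volume≤1 S = ℚ.≤-trans (sumℚ-mono-≤ (λ j → if-preserves (_≤ π j) (S j) (Fv≤π j) (nonneg j)))
                         (ℚ.≤-reflexive normalised)

  Fe≤boundary : ∀ S {i j} → S i ≡ true → S j ≡ false → Fe k A π i j ≤ boundary k A π S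
  Fe≤boundary S {i} {j} Si Sj = begin
    Fe k A π i j  ≡⟨ cut-edge ⟨
    cut i j       ≤⟨ term≤sumℚ (cut i) (cut-nonNeg i) j ⟩
    sumℚ (cut i)  ≤⟨ term≤sumℚ (sumℚ ∘ cut) (λ i′ → sumℚ-nonNeg (cut i′) (cut-nonNeg i′)) i ⟩
    boundary k A π S ∎
    where
    open ℚ.≤-Reasoning
    cut : Fin n → Fin n → ℚ
    cut i j = if S i then (if S j then 0ℚ else Fe k A π i j) else 0ℚ
    cut-nonNeg : ∀ i j → 0ℚ ≤ cut i j
    cut-nonNeg i j = if-preserves (0ℚ ≤_) (S i) (if-preserves (0ℚ ≤_) (S j) ℚ.≤-refl (Fe-nonNeg i j)) ℚ.≤-refl
    cut-edge : cut i j ≡ Fe k A π i j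
    cut-edge rewrite Si | Sj = refl

edge-flow-lower-bound : ∀ {m} (k : ℕ) .{{_ : NonZero k}} {A : Matrix (suc m)} → Connected A →
  (π : Fin (suc m) → ℚ) → IsStationary k A π →
  ∀ {i j} → 0 ℕ.< A i j → 1ℚ ≤ Fe k A π i j * fromℕ (k ^ suc m ℕ.* suc m)
edge-flow-lower-bound {m} k {A} conn π stationary {i} {j} i→j = begin
  1ℚ                                          ≡⟨ normalised ⟨
  sumℚ π                                      ≤⟨ sumℚ≤const*size π (π top) π≤top ⟩
  π top * fromℕ N                             ≤⟨ ℚ.*-monoʳ-≤-nonNeg (fromℕ N) π-top≤ ⟩
  F * fromℕ k * fromℕ (k ^ m) * fromℕ N       ≡⟨ cong (_* fromℕ N) (ℚ.*-assoc F (fromℕ k) (fromℕ (k ^ m))) ⟩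
  F * (fromℕ k * fromℕ (k ^ m)) * fromℕ N     ≡⟨ cong (λ x → F * x * fromℕ N) (fromℕ-* k (k ^ m)) ⟨
  F * fromℕ (k ^ N) * fromℕ N                 ≡⟨ ℚ.*-assoc F (fromℕ (k ^ N)) (fromℕ N) ⟩
  F * (fromℕ (k ^ N) * fromℕ N)               ≡⟨ cong (F *_) (fromℕ-* (k ^ N) N) ⟨
  F * fromℕ (k ^ N ℕ.* N)                     ∎
  where
  open ℚ.≤-Reasoning
  open IsStationary stationary
  open Stationary k A π stationary
  N = suc m
  F = Fe k A π i j
  top = proj₁ (argmax π)
  π≤top = proj₂ (argmax π)
  π-top≤ : π top ≤ F * fromℕ k * fromℕ (k ^ m)
  π-top≤ = ℚ.≤-trans (ratio-bound conn π nonneg k π-edge top i)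
                     (ℚ.*-monoʳ-≤-nonNeg (fromℕ (k ^ m)) (π≤Fe*k i→j))

square-swap : ∀ m a → m ^ 2 ℕ.* a ≡ a ℕ.* m ℕ.* m
square-swap = solve 2 (λ m a → (m :^ 2) :* a := a :* m :* m) refl
  where open +-*-Solver

instance
  N²kᴺ≢0 : ∀ {N k} .{{_ : NonZero N}} .{{_ : NonZero k}} → NonZero (N ^ 2 ℕ.* k ^ N)
  N²kᴺ≢0 {N} {k} = ℕ.m*n≢0 (N ^ 2) (k ^ N) {{ℕ.m^n≢0 N 2}} {{ℕ.m^n≢0 k N}}

bound-nonNeg : ∀ N k .{{_ : NonZero N}} .{{_ : NonZero k}} → NonNegative (bound N k)
bound-nonNeg N k = ℚ.normalize-nonNeg 2 (N ^ 2 ℕ.* k ^ N)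

bound≤ : ∀ N k .{{_ : NonZero N}} .{{_ : NonZero k}} x → 2 ℕ.≤ N →
         1ℚ ≤ x * fromℕ (k ^ N ℕ.* N) → bound N k ≤ x
bound≤ N k x 2≤N 1≤x*kᴺN = ℚ.*-cancelʳ-≤-pos (fromℕ M) {{fromℕ-pos M}} (begin
  bound N k * fromℕ M             ≡⟨ /-*-fromℕ 2 M ⟩
  fromℕ 2                         ≤⟨ fromℕ-mono-≤ 2≤N ⟩
  fromℕ N                         ≡⟨ trans (cong (fromℕ N *_) fromℕ-1) (ℚ.*-identityʳ (fromℕ N)) ⟨
  fromℕ N * fromℕ 1               ≤⟨ ℚ.*-monoˡ-≤-nonNeg (fromℕ N) (ℚ.≤-trans (ℚ.≤-reflexive fromℕ-1) 1≤x*kᴺN) ⟩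
  fromℕ N * (x * fromℕ (k ^ N ℕ.* N))  ≡⟨ ℚ.*-comm (fromℕ N) _ ⟩
  x * fromℕ (k ^ N ℕ.* N) * fromℕ N    ≡⟨ ℚ.*-assoc x _ (fromℕ N) ⟩
  x * (fromℕ (k ^ N ℕ.* N) * fromℕ N)  ≡⟨ cong (x *_) (trans (cong fromℕ (square-swap N (k ^ N))) (fromℕ-* (k ^ N ℕ.* N) N)) ⟨
  x * fromℕ M                     ∎)
  where
  open ℚ.≤-Reasoning
  M = N ^ 2 ℕ.* k ^ N

proposition5p1 : (n k : ℕ) .{{_ : NonZero n}} .{{_ : NonZero k}}
    (A : Matrix n) → IsOrbigraph n k A → Connected A →
    (π : Fin n → ℚ) → IsStationary k A π →
    CheegerAtLeast k A π (bound n k)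
proposition5p1 (suc zero) _ _ _ _ _ _ _ ((zero , S0) , (zero , ¬S0)) with () ← trans (sym S0) ¬S0
proposition5p1 n@(suc (suc _)) k A _ conn π stationary S ((s , Ss) , (t , ¬St))
  with walk-crosses (λ v → S v ≟ true) (conn s t) Ss (not-¬ ¬St)
... | i , j , Si , ¬Sj , i→j = begin
  bound n k * (volume k A π S ⊓ volume k A π (not ∘ S))
      ≤⟨ ℚ.*-monoˡ-≤-nonNeg (bound n k) {{bound-nonNeg n k}} (ℚ.≤-trans (ℚ.p⊓q≤p _ _) (volume≤1 S)) ⟩
  bound n k * 1ℚ     ≡⟨ ℚ.*-identityʳ (bound n k) ⟩
  bound n k          ≤⟨ bound≤ n k _ (s≤s (s≤s z≤n)) (edge-flow-lower-bound k conn π stationary i→j) ⟩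
  Fe k A π i j       ≤⟨ Fe≤boundary S Si (¬-not ¬Sj) ⟩
  boundary k A π S   ∎
  where
  open ℚ.≤-Reasoning
  open Stationary k A π stationary
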